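{- Let $m\ge3$ be an integer and define $R_m$ as follows: $R_3=\{0\}$; $R_5=\{0,1,2,3,5,7,13,26,27,28,29,31\}$; $R_7=\{0,1,2,3,4,5,7,10,33,34,35,36,37,38\}$; for $m=2n$ with $n>1$, $R_m=\{0,1,\ldots,2n\}$; for $m=2n+1$ with $n>3$, $R_m=N\cup\{3n+1\}\cup\{x+2n^2+5n:x\in N\}$ with $N=\{0,\ldots,2n-1\}\cup\{2n+1\}$. Then for every $r_1\in R_m$ there exist $r_2,\ldots,r_m\in R_m$ such that $r_2,\ldots,r_{m-1}$ are pairwise distinct and $r_1+r_2+\cdots+r_{m-1}=(m-1)r_m$. -}

module Defs where

open import Data.Nat using (ℕ; zero; suc; _+_; _*_; _≤_; _<_)
open import Data.List using (List; _∷_; [])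
open import Data.List.Membership.Propositional using (_∈_)
open import Data.Product using (∃; _×_)
open import Data.Sum using (_⊎_)
open import Relation.Binary.PropositionalEquality using (_≡_)

sumFrom : (a k : ℕ) → (ℕ → ℕ) → ℕ
sumFrom a zero    f = 0
sumFrom a (suc k) f = f a + sumFrom (suc a) k f

InN : ℕ → ℕ → Set
InN n x = x < 2 * n ⊎ x ≡ 2 * n + 1

R5 : List ℕ
R5 = 0 ∷ 1 ∷ 2 ∷ 3 ∷ 5 ∷ 7 ∷ 13 ∷ 26 ∷ 27 ∷ 28 ∷ 29 ∷ 31 ∷ []

R7 : List ℕ
R7 = 0 ∷ 1 ∷ 2 ∷ 3 ∷ 4 ∷ 5 ∷ 7 ∷ 10 ∷ 33 ∷ 34 ∷ 35 ∷ 36 ∷ 37 ∷ 38 ∷ []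

-- InR m x  means  x ∈ R_m.  The five cases (m = 3, 5, 7, 2n with n > 1,
-- 2n+1 with n > 3) are mutually exclusive; R_m is empty for m < 3.
InR : ℕ → ℕ → Set
InR m x =
    (m ≡ 3 × x ≡ 0)
  ⊎ (m ≡ 5 × x ∈ R5)
  ⊎ (m ≡ 7 × x ∈ R7)
  ⊎ (∃ λ n → 1 < n × m ≡ 2 * n × x ≤ 2 * n)
  ⊎ (∃ λ n → 3 < n × m ≡ 2 * n + 1 ×
        (InN n x ⊎ x ≡ 3 * n + 1 ⊎ (∃ λ y → InN n y × x ≡ y + 2 * (n * n) + 5 * n)))

module Submission where

-- Write m = k + 2, so that r₂, …, r_{m-1} are k values.  Call a family of k
-- pairwise distinct values f 0, …, f (k-1) together with a "mean" c a
-- completion of r₁ when r₁ + f 0 + … + f (k-1) = (k+1)·c, all values lying in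
-- a given set P.  A completion of r₁ inside R_m is exactly what lemma6 asks for.
--
-- Almost all completions come from one family: the k numbers {0, …, k} ∖ {h},
-- whose sum is k(k+1)/2 − h (Gauss).  Choosing the omitted number h and the
-- mean c solves the balance equation in every infinite family: for m = 2n the
-- values lie in {0,…,2n} = R_m; for m = 2n+1 they lie in N ⊆ R_m, and the
-- translate N + (2n² + 5n) ⊆ R_m is handled by translating a completion.  For
-- m = 3, 5, 7 the completions are explicit strictly increasing lists, checked by
-- evaluation.

open import Defs
open import Data.Nat using (ℕ; zero; suc; _+_; _*_; _∸_; _≤_; _<_; z≤n; s≤s; _<?_; _≟_)
open import Data.Nat.Properties
open import Data.Nat.Tactic.RingSolver using (solve-∀)
open import Data.List using (List; []; _∷_; length)
open import Data.Nat.ListAction using (sum)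
open import Data.List.Relation.Unary.All as All using (All; []; _∷_; all?)
open import Data.List.Relation.Unary.AllPairs using (AllPairs; []; _∷_; allPairs?)
open import Data.List.Membership.Propositional using (_∈_)
open import Data.List.Membership.DecPropositional _≟_ using (_∈?_)
open import Data.Product using (∃; _×_; _,_)
open import Data.Sum using (_⊎_; inj₁; inj₂)
open import Relation.Nullary using (Dec; yes; no; contradiction)
open import Relation.Nullary.Decidable using (True; toWitness; _×-dec_)
open import Relation.Binary.PropositionalEquality
  using (_≡_; _≢_; refl; sym; trans; cong; cong₂; subst; module ≡-Reasoning)

open ≡-Reasoning

sum-shift : ∀ a k f → sumFrom (suc a) k f ≡ sumFrom a k (λ j → f (suc j))
sum-shift a zero    f = refl
sum-shift a (suc k) f = cong (f (suc a) +_) (sum-shift (suc a) k f)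

sum-cong : ∀ a k {f g} → (∀ i → i < a + k → f i ≡ g i) → sumFrom a k f ≡ sumFrom a k g
sum-cong a zero    f≗g = refl
sum-cong a (suc k) f≗g =
  cong₂ _+_ (f≗g a (m<m+n a (s≤s z≤n)))
            (sum-cong (suc a) k (λ i i< → f≗g i (subst (i <_) (sym (+-suc a k)) i<)))

sum-const+ : ∀ a k f c → sumFrom a k (λ j → c + f j) ≡ k * c + sumFrom a k f
sum-const+ a zero    f c = refl
sum-const+ a (suc k) f c = begin
  c + f a + sumFrom (suc a) k (λ j → c + f j) ≡⟨ cong (c + f a +_) (sum-const+ (suc a) k f c) ⟩
  c + f a + (k * c + sumFrom (suc a) k f)     ≡⟨ regroup c (f a) (k * c) _ ⟩
  c + k * c + (f a + sumFrom (suc a) k f)     ∎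
  where
  regroup : ∀ x y z w → x + y + (z + w) ≡ x + z + (y + w)
  regroup = solve-∀

sum-suc : ∀ a k f → sumFrom a k (λ j → suc (f j)) ≡ k + sumFrom a k f
sum-suc a k f = trans (sum-const+ a k f 1) (cong (_+ sumFrom a k f) (*-identityʳ k))

triangle : ℕ → ℕ
triangle k = sumFrom 0 (suc k) (λ j → j)

triangle-suc : ∀ k → triangle (suc k) ≡ suc k + triangle k
triangle-suc k = trans (sum-shift 0 (suc k) (λ j → j)) (sum-suc 0 (suc k) (λ j → j))

gauss : ∀ k → 2 * triangle k ≡ k * suc k
gauss zero    = refl
gauss (suc k) = begin
  2 * triangle (suc k)           ≡⟨ cong (2 *_) (triangle-suc k) ⟩
  2 * (suc k + triangle k)       ≡⟨ *-distribˡ-+ 2 (suc k) (triangle k) ⟩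
  2 * suc k + 2 * triangle k     ≡⟨ cong (2 * suc k +_) (gauss k) ⟩
  2 * suc k + k * suc k          ≡⟨ step k ⟩
  suc k * suc (suc k)            ∎
  where
  step : ∀ k → 2 * suc k + k * suc k ≡ suc k * suc (suc k)
  step = solve-∀

-- skip h enumerates ℕ ∖ {h} increasingly: skip h j is j below h and j + 1 from h on.
skip : ℕ → ℕ → ℕ
skip zero    j       = suc j
skip (suc h) zero    = zero
skip (suc h) (suc j) = suc (skip h j)

skip-< : ∀ h {i j} → i < j → skip h i < skip h j
skip-< zero    i<j                 = s≤s i<j
skip-< (suc h) {zero}  {suc j} _   = s≤s z≤n
skip-< (suc h) {suc i} {suc j} i<j = s≤s (skip-< h (≤-pred i<j))

skip-≤ : ∀ h j → skip h j ≤ suc j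
skip-≤ zero    j       = ≤-refl
skip-≤ (suc h) zero    = z≤n
skip-≤ (suc h) (suc j) = s≤s (skip-≤ h j)

-- For h ≤ k the first k values of skip h are {0, …, k} ∖ {h}.
sum-skip : ∀ {h k} → h ≤ k → sumFrom 0 k (skip h) + h ≡ triangle k
sum-skip {zero}  {k}     _   = trans (+-identityʳ _) (sym (sum-shift 0 k (λ j → j)))
sum-skip {suc h} {suc k} h≤k = begin
  sumFrom 0 (suc k) (skip (suc h)) + suc h   ≡⟨ cong (_+ suc h) (sum-shift 0 k (skip (suc h))) ⟩
  sumFrom 0 k (λ j → suc (skip h j)) + suc h ≡⟨ cong (_+ suc h) (sum-suc 0 k (skip h)) ⟩
  k + sumFrom 0 k (skip h) + suc h           ≡⟨ regroup k (sumFrom 0 k (skip h)) h ⟩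
  suc k + (sumFrom 0 k (skip h) + h)         ≡⟨ cong (suc k +_) (sum-skip (≤-pred h≤k)) ⟩
  suc k + triangle k                         ≡⟨ sym (triangle-suc k) ⟩
  triangle (suc k)                           ∎
  where
  regroup : ∀ x y z → x + y + suc z ≡ suc x + (y + z)
  regroup = solve-∀

record Completion (k : ℕ) (P : ℕ → Set) (r₁ : ℕ) : Set where
  field
    value    : ℕ → ℕ
    mean     : ℕ
    value∈P  : ∀ j → j < k → P (value j)
    mean∈P   : P mean
    distinct : ∀ i j → i < j → j < k → value i ≢ value j
    balanced : r₁ + sumFrom 0 k value ≡ suc k * mean

weaken : ∀ {k P Q r₁} → (∀ {x} → P x → Q x) → Completion k P r₁ → Completion k Q r₁
weaken P⊆Q C = record
  { value = value ; mean = mean ; value∈P = λ j j<k → P⊆Q (value∈P j j<k)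
  ; mean∈P = P⊆Q mean∈P ; distinct = distinct ; balanced = balanced }
  where open Completion C

translate : ∀ {k P r₁} off → Completion k (λ x → P (off + x)) r₁ → Completion k P (off + r₁)
translate {k} {P} {r₁} off C = record
  { value = λ j → off + value j ; mean = off + mean ; value∈P = value∈P ; mean∈P = mean∈P
  ; distinct = λ i j i<j j<k eq → distinct i j i<j j<k (+-cancelˡ-≡ off _ _ eq)
  ; balanced = balanced′ }
  where
  open Completion C
  S = sumFrom 0 k value
  balanced′ : off + r₁ + sumFrom 0 k (λ j → off + value j) ≡ suc k * (off + mean)
  balanced′ = begin
    off + r₁ + sumFrom 0 k (λ j → off + value j) ≡⟨ cong (off + r₁ +_) (sum-const+ 0 k value off) ⟩
    off + r₁ + (k * off + S)                     ≡⟨ regroup off r₁ k S ⟩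
    suc k * off + (r₁ + S)                       ≡⟨ cong (suc k * off +_) balanced ⟩
    suc k * off + suc k * mean                   ≡⟨ sym (*-distribˡ-+ (suc k) off mean) ⟩
    suc k * (off + mean)                         ∎
    where
    regroup : ∀ x r k s → x + r + (k * x + s) ≡ suc k * x + (r + s)
    regroup = solve-∀

-- The values {0, …, k} ∖ {h} complete r₁ with mean c as soon as
-- r₁ + (0 + … + k) = h + (k+1)·c; the hypothesis is that equation doubled, so
-- that Gauss' formula can be used without division.
skipping : ∀ {k P h r₁ c} → h ≤ k → (∀ x → x ≤ k → P x) → P c →
           2 * r₁ + k * suc k ≡ 2 * (h + suc k * c) → Completion k P r₁
skipping {k} {P} {h} {r₁} {c} h≤k P-upto Pc doubled = record
  { value = skip h ; mean = c
  ; value∈P = λ j j<k → P-upto _ (≤-trans (skip-≤ h j) j<k) ; mean∈P = Pc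
  ; distinct = λ i j i<j _ → <⇒≢ (skip-< h i<j)
  ; balanced = *-cancelˡ-≡ _ _ 2 (+-cancelʳ-≡ (2 * h) _ _ twice) }
  where
  S = sumFrom 0 k (skip h)
  twice : 2 * (r₁ + S) + 2 * h ≡ 2 * (suc k * c) + 2 * h
  twice = begin
    2 * (r₁ + S) + 2 * h      ≡⟨ regroup r₁ S h ⟩
    2 * r₁ + 2 * (S + h)      ≡⟨ cong (λ t → 2 * r₁ + 2 * t) (sum-skip h≤k) ⟩
    2 * r₁ + 2 * triangle k   ≡⟨ cong (2 * r₁ +_) (gauss k) ⟩
    2 * r₁ + k * suc k        ≡⟨ doubled ⟩
    2 * (h + suc k * c)       ≡⟨ swap h (suc k * c) ⟩
    2 * (suc k * c) + 2 * h   ∎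
    where
    regroup : ∀ r s h → 2 * (r + s) + 2 * h ≡ 2 * r + 2 * (s + h)
    regroup = solve-∀
    swap : ∀ h t → 2 * (h + t) ≡ 2 * t + 2 * h
    swap = solve-∀

-- nth L j is the j-th entry of L (and 0 past its end).
nth : List ℕ → ℕ → ℕ
nth []      _       = 0
nth (x ∷ L) zero    = x
nth (x ∷ L) (suc j) = nth L j

nth-sum : ∀ L → sumFrom 0 (length L) (nth L) ≡ sum L
nth-sum []      = refl
nth-sum (x ∷ L) = cong (x +_) (trans (sum-shift 0 (length L) (nth (x ∷ L))) (nth-sum L))

nth-All : ∀ {P : ℕ → Set} {L j} → All P L → j < length L → P (nth L j)
nth-All {j = zero}  (p ∷ ps) _   = p
nth-All {j = suc j} (p ∷ ps) j<  = nth-All ps (≤-pred j<)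

nth-increasing : ∀ {L i j} → AllPairs _<_ L → i < j → j < length L → nth L i < nth L j
nth-increasing {i = zero}  {suc j} (x< ∷ _)   _   j< = nth-All x< (≤-pred j<)
nth-increasing {i = suc i} {suc j} (_ ∷ inc) i<j j< = nth-increasing inc (≤-pred i<j) (≤-pred j<)

listed : ∀ {P : ℕ → Set} {r₁ c L} → All P L → AllPairs _<_ L → P c →
         r₁ + sum L ≡ suc (length L) * c → Completion (length L) P r₁
listed {r₁ = r₁} {c} {L} P-L inc Pc eq = record
  { value = nth L ; mean = c ; value∈P = λ j → nth-All P-L ; mean∈P = Pc
  ; distinct = λ i j i<j j< → <⇒≢ (nth-increasing inc i<j j<)
  ; balanced = trans (cong (r₁ +_) (nth-sum L)) eq }

Certificate : List ℕ → ℕ → ℕ → List ℕ → Set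
Certificate R r₁ c L =
  All (_∈ R) L × AllPairs _<_ L × c ∈ R × r₁ + sum L ≡ suc (length L) * c

certificate? : ∀ R r₁ c L → Dec (Certificate R r₁ c L)
certificate? R r₁ c L =
  all? (_∈? R) L ×-dec allPairs? _<?_ L ×-dec c ∈? R ×-dec r₁ + sum L ≟ suc (length L) * c

certified : ∀ R r₁ c L → {True (certificate? R r₁ c L)} → Completion (length L) (_∈ R) r₁
certified R r₁ c L {ok} with toWitness ok
... | P-L , inc , c∈R , eq = listed P-L inc c∈R eq

Goal : ℕ → ℕ → Set
Goal m r₁ = ∃ λ (r : ℕ → ℕ) →
  (∀ i → 2 ≤ i → i ≤ m → InR m (r i)) ×
  (∀ i j → 2 ≤ i → i < j → j ≤ m ∸ 1 → r i ≢ r j) ×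
  (r₁ + sumFrom 2 (m ∸ 2) r ≡ (m ∸ 1) * r m)

place : ℕ → (ℕ → ℕ) → ℕ → ℕ → ℕ
place m f c i with i <? m
... | yes _ = f (i ∸ 2)
... | no  _ = c

place-< : ∀ {m i} f c → i < m → place m f c i ≡ f (i ∸ 2)
place-< {m} {i} f c i<m with i <? m
... | yes _   = refl
... | no  i≮m = contradiction i<m i≮m

place-m : ∀ m f c → place m f c m ≡ c
place-m m f c with m <? m
... | yes m<m = contradiction m<m (<-irrefl refl)
... | no  _   = refl

completion⇒goal : ∀ {m k r₁} → m ≡ 2 + k → Completion k (InR m) r₁ → Goal m r₁
completion⇒goal {m} {k} {r₁} refl C = r , in-R , distinct′ , balanced′
  where
  open Completion C
  r : ℕ → ℕ
  r = place m value mean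
  in-R : ∀ i → 2 ≤ i → i ≤ m → InR m (r i)
  in-R i 2≤i i≤m with m≤n⇒m<n∨m≡n i≤m
  ... | inj₁ i<m  = subst (InR m) (sym (place-< value mean i<m))
                          (value∈P (i ∸ 2) (∸-monoˡ-< i<m 2≤i))
  ... | inj₂ refl = subst (InR m) (sym (place-m m value mean)) mean∈P
  distinct′ : ∀ i j → 2 ≤ i → i < j → j ≤ m ∸ 1 → r i ≢ r j
  distinct′ i j 2≤i i<j j<m eq =
    distinct (i ∸ 2) (j ∸ 2) (∸-monoˡ-< i<j 2≤i) (∸-monoˡ-< (s≤s j<m) (≤-trans 2≤i (<⇒≤ i<j)))
      (trans (sym (place-< value mean (<-trans i<j (s≤s j<m))))
             (trans eq (place-< value mean (s≤s j<m))))
  balanced′ : r₁ + sumFrom 2 k r ≡ suc k * r m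
  balanced′ = begin
    r₁ + sumFrom 2 k r                     ≡⟨ cong (r₁ +_) (sum-cong 2 k (λ i → place-< value mean)) ⟩
    r₁ + sumFrom 2 k (λ i → value (i ∸ 2)) ≡⟨ cong (r₁ +_) (trans (sum-shift 1 k _) (sum-shift 0 k _)) ⟩
    r₁ + sumFrom 0 k value                 ≡⟨ balanced ⟩
    suc k * mean                           ≡⟨ cong (suc k *_) (sym (place-m m value mean)) ⟩
    suc k * r m                            ∎

completion₃ : Completion 1 (InR 3) 0
completion₃ = listed {L = 0 ∷ []} (R₃∋0 ∷ []) ([] ∷ []) R₃∋0 refl
  where
  R₃∋0 : InR 3 0
  R₃∋0 = inj₁ (refl , refl)

completions₅ : All (Completion 3 (_∈ R5)) R5
completions₅ =
    certified R5  0  1 (0 ∷ 1 ∷ 3 ∷ [])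
  ∷ certified R5  1  1 (0 ∷ 1 ∷ 2 ∷ [])
  ∷ certified R5  2  2 (0 ∷ 1 ∷ 5 ∷ [])
  ∷ certified R5  3  2 (0 ∷ 2 ∷ 3 ∷ [])
  ∷ certified R5  5  2 (0 ∷ 1 ∷ 2 ∷ [])
  ∷ certified R5  7  3 (0 ∷ 2 ∷ 3 ∷ [])
  ∷ certified R5 13  5 (0 ∷ 2 ∷ 5 ∷ [])
  ∷ certified R5 26 27 (26 ∷ 27 ∷ 29 ∷ [])
  ∷ certified R5 27 13 (5 ∷ 7 ∷ 13 ∷ [])
  ∷ certified R5 28 28 (26 ∷ 27 ∷ 31 ∷ [])
  ∷ certified R5 29 13 (3 ∷ 7 ∷ 13 ∷ [])
  ∷ certified R5 31 13 (1 ∷ 7 ∷ 13 ∷ [])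
  ∷ []

completions₇ : All (Completion 5 (_∈ R7)) R7
completions₇ =
    certified R7  0  7 (0 ∷ 1 ∷ 2 ∷ 3 ∷ 36 ∷ [])
  ∷ certified R7  1  2 (0 ∷ 1 ∷ 2 ∷ 3 ∷ 5 ∷ [])
  ∷ certified R7  2  2 (0 ∷ 1 ∷ 2 ∷ 3 ∷ 4 ∷ [])
  ∷ certified R7  3  7 (0 ∷ 1 ∷ 2 ∷ 3 ∷ 33 ∷ [])
  ∷ certified R7  4  3 (0 ∷ 1 ∷ 2 ∷ 4 ∷ 7 ∷ [])
  ∷ certified R7  5  3 (0 ∷ 1 ∷ 2 ∷ 3 ∷ 7 ∷ [])
  ∷ certified R7  7  3 (0 ∷ 1 ∷ 2 ∷ 3 ∷ 5 ∷ [])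
  ∷ certified R7 10  4 (0 ∷ 1 ∷ 2 ∷ 4 ∷ 7 ∷ [])
  ∷ certified R7 33 10 (1 ∷ 4 ∷ 5 ∷ 7 ∷ 10 ∷ [])
  ∷ certified R7 34 10 (0 ∷ 4 ∷ 5 ∷ 7 ∷ 10 ∷ [])
  ∷ certified R7 35 10 (0 ∷ 3 ∷ 5 ∷ 7 ∷ 10 ∷ [])
  ∷ certified R7 36 10 (0 ∷ 2 ∷ 5 ∷ 7 ∷ 10 ∷ [])
  ∷ certified R7 37 10 (0 ∷ 1 ∷ 5 ∷ 7 ∷ 10 ∷ [])
  ∷ certified R7 38 10 (0 ∷ 1 ∷ 4 ∷ 7 ∷ 10 ∷ [])
  ∷ []

top-three : ∀ {x k} → x ≤ 2 + k → x ≤ k ⊎ x ≡ 1 + k ⊎ x ≡ 2 + k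
top-three x≤ with m≤n⇒m<n∨m≡n x≤
... | inj₂ x≡ = inj₂ (inj₂ x≡)
... | inj₁ x< with m≤n⇒m<n∨m≡n (≤-pred x<)
...   | inj₂ x≡  = inj₂ (inj₁ x≡)
...   | inj₁ x<′ = inj₁ (≤-pred x<′)

-- m = 2n with n = p + 2: k = 2p + 2 values and R_m = {0, …, 2n}.  Skipping r₁
-- itself (mean p + 1) handles r₁ ≤ k; skipping 0 or 1 (mean n) handles k+1, k+2.
module Even (p : ℕ) where
  n k : ℕ
  n = 2 + p
  k = 2 + 2 * p

  m≡2+k : 2 * n ≡ 2 + k
  m≡2+k = identity p
    where
    identity : ∀ p → 2 * (2 + p) ≡ 2 + (2 + 2 * p)
    identity = solve-∀

  member : ∀ {x} → x ≤ 2 * n → InR (2 * n) x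
  member x≤2n = inj₂ (inj₂ (inj₂ (inj₁ (n , s≤s (s≤s z≤n) , refl , x≤2n))))

  upto-k : ∀ x → x ≤ k → InR (2 * n) x
  upto-k x x≤k = member (≤-trans x≤k (subst (k ≤_) (sym m≡2+k) (m≤n+m k 2)))

  n≤2n : n ≤ 2 * n
  n≤2n = m≤m+n n (n + 0)

  completion : ∀ {r₁} → r₁ ≤ 2 * n → Completion k (InR (2 * n)) r₁
  completion {r₁} r₁≤2n with top-three {k = k} (subst (r₁ ≤_) m≡2+k r₁≤2n)
  ... | inj₁ r₁≤k        = skipping r₁≤k upto-k (member (≤-trans (n≤1+n _) n≤2n)) (balance-low p r₁)
    where
    balance-low : ∀ p r → 2 * r + (2 + 2 * p) * suc (2 + 2 * p)
                        ≡ 2 * (r + suc (2 + 2 * p) * (1 + p))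
    balance-low = solve-∀
  ... | inj₂ (inj₁ refl) = skipping z≤n upto-k (member n≤2n) (balance-k+1 p)
    where
    balance-k+1 : ∀ p → 2 * (1 + (2 + 2 * p)) + (2 + 2 * p) * suc (2 + 2 * p)
                      ≡ 2 * (0 + suc (2 + 2 * p) * (2 + p))
    balance-k+1 = solve-∀
  ... | inj₂ (inj₂ refl) = skipping (s≤s z≤n) upto-k (member n≤2n) (balance-k+2 p)
    where
    balance-k+2 : ∀ p → 2 * (2 + (2 + 2 * p)) + (2 + 2 * p) * suc (2 + 2 * p)
                      ≡ 2 * (1 + suc (2 + 2 * p) * (2 + p))
    balance-k+2 = solve-∀

halve : ∀ {n y} → y < 2 * n → y + n < 2 * n ⊎ ∃ λ s → y ≡ n + s × s < 2 * n
halve {n} {y} y<2n with y <? n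
... | yes y<n = inj₁ (subst (y + n <_) (cong (n +_) (sym (+-identityʳ n))) (+-monoˡ-< n y<n))
... | no  y≮n with m≤n⇒∃[o]m+o≡n (≮⇒≥ y≮n)
...   | s , n+s≡y = inj₂ (s , sym n+s≡y , ≤-<-trans (subst (s ≤_) n+s≡y (m≤n+m s n)) y<2n)

-- m = 2n + 1 with n = a + 2 > 3: k = 2n − 1 values, all chosen from
-- {0, …, 2n − 1} ⊆ N.  For y ∈ N one skips y + n (mean n − 1, when y < n),
-- y − n (mean n, when n ≤ y < 2n) or n + 1 (mean n, when y = 2n + 1); for 3n + 1
-- one skips 1 (mean n + 1); the translate N + K is reduced to N by translation.
module Odd (a : ℕ) (3<n : 3 < 2 + a) where
  n k K : ℕ
  n = 2 + a
  k = 3 + 2 * a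
  K = 2 * (n * n) + 5 * n

  m≡2+k : 2 * n + 1 ≡ 2 + k
  m≡2+k = identity a
    where
    identity : ∀ a → 2 * (2 + a) + 1 ≡ 2 + (3 + 2 * a)
    identity = solve-∀

  2n≡1+k : 2 * n ≡ suc k
  2n≡1+k = identity a
    where
    identity : ∀ a → 2 * (2 + a) ≡ suc (3 + 2 * a)
    identity = solve-∀

  K+≡ : ∀ x → K + x ≡ x + 2 * (n * n) + 5 * n
  K+≡ x = trans (+-comm K x) (sym (+-assoc x (2 * (n * n)) (5 * n)))

  member : ∀ {x} → InN n x ⊎ x ≡ 3 * n + 1 ⊎ (∃ λ y → InN n y × x ≡ y + 2 * (n * n) + 5 * n) →
           InR (2 * n + 1) x
  member x∈R = inj₂ (inj₂ (inj₂ (inj₂ (n , 3<n , refl , x∈R))))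

  below : ∀ {x} → x < 2 * n → x ≤ k
  below {x} x<2n = ≤-pred (subst (x <_) 2n≡1+k x<2n)

  in-N : ∀ {x} → x ≤ k → InN n x
  in-N {x} x≤k = inj₁ (subst (x <_) (sym 2n≡1+k) (s≤s x≤k))

  within : ∀ {Q : ℕ → Set} → (∀ {x} → InN n x → Q x) → ∀ x → x ≤ k → Q x
  within N⊆Q x x≤k = N⊆Q (in-N x≤k)

  1+n≤k : 1 + n ≤ k
  1+n≤k = +-monoʳ-≤ 3 (m≤m+n a (a + 0))

  n≤k : n ≤ k
  n≤k = ≤-trans (n≤1+n n) 1+n≤k

  n-1≤k : 1 + a ≤ k
  n-1≤k = ≤-trans (n≤1+n _) n≤k

  from-N : ∀ {Q : ℕ → Set} → (∀ {x} → InN n x → Q x) → ∀ {y} → InN n y → Completion k Q y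
  from-N N⊆Q (inj₂ refl) = skipping 1+n≤k (within N⊆Q) (N⊆Q (in-N n≤k)) (balance-2n+1 a)
    where
    balance-2n+1 : ∀ a → 2 * (2 * (2 + a) + 1) + (3 + 2 * a) * suc (3 + 2 * a)
                       ≡ 2 * (1 + (2 + a) + suc (3 + 2 * a) * (2 + a))
    balance-2n+1 = solve-∀
  from-N N⊆Q {y} (inj₁ y<2n) with halve y<2n
  ... | inj₁ y+n<2n =
    skipping (below y+n<2n) (within N⊆Q) (N⊆Q (in-N n-1≤k)) (balance-low a y)
    where
    balance-low : ∀ a y → 2 * y + (3 + 2 * a) * suc (3 + 2 * a)
                        ≡ 2 * (y + (2 + a) + suc (3 + 2 * a) * (1 + a))
    balance-low = solve-∀
  ... | inj₂ (s , refl , s<2n) =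
    skipping (below s<2n) (within N⊆Q) (N⊆Q (in-N n≤k)) (balance-high a s)
    where
    balance-high : ∀ a s → 2 * (2 + a + s) + (3 + 2 * a) * suc (3 + 2 * a)
                         ≡ 2 * (s + suc (3 + 2 * a) * (2 + a))
    balance-high = solve-∀

  completion : ∀ {r₁} →
    InN n r₁ ⊎ r₁ ≡ 3 * n + 1 ⊎ (∃ λ y → InN n y × r₁ ≡ y + 2 * (n * n) + 5 * n) →
    Completion k (InR (2 * n + 1)) r₁
  completion (inj₁ r₁∈N) = from-N N⊆R r₁∈N
    where
    N⊆R : ∀ {x} → InN n x → InR (2 * n + 1) x
    N⊆R x∈N = member (inj₁ x∈N)
  completion (inj₂ (inj₁ refl)) =
    skipping (s≤s z≤n) (within N⊆R) (N⊆R (in-N 1+n≤k)) (balance-3n+1 a)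
    where
    N⊆R : ∀ {x} → InN n x → InR (2 * n + 1) x
    N⊆R x∈N = member (inj₁ x∈N)
    balance-3n+1 : ∀ a → 2 * (3 * (2 + a) + 1) + (3 + 2 * a) * suc (3 + 2 * a)
                       ≡ 2 * (1 + suc (3 + 2 * a) * (1 + (2 + a)))
    balance-3n+1 = solve-∀
  completion (inj₂ (inj₂ (y , y∈N , refl))) =
    subst (Completion k (InR (2 * n + 1))) (K+≡ y) (translate K (from-N N+K⊆R y∈N))
    where
    N+K⊆R : ∀ {x} → InN n x → InR (2 * n + 1) (K + x)
    N+K⊆R {x} x∈N = member (inj₂ (inj₂ (x , x∈N , K+≡ x)))

lemma6 : (m : ℕ) → 3 ≤ m → (r₁ : ℕ) → InR m r₁ →
    ∃ λ (r : ℕ → ℕ) →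
      (∀ i → 2 ≤ i → i ≤ m → InR m (r i)) ×
      (∀ i j → 2 ≤ i → i < j → j ≤ m ∸ 1 → r i ≢ r j) ×
      (r₁ + sumFrom 2 (m ∸ 2) r ≡ (m ∸ 1) * r m)
lemma6 .3 _ .0 (inj₁ (refl , refl)) = completion⇒goal refl completion₃
lemma6 .5 _ r₁ (inj₂ (inj₁ (refl , r₁∈R₅))) =
  completion⇒goal refl (weaken (λ x∈R₅ → inj₂ (inj₁ (refl , x∈R₅))) (All.lookup completions₅ r₁∈R₅))
lemma6 .7 _ r₁ (inj₂ (inj₂ (inj₁ (refl , r₁∈R₇)))) =
  completion⇒goal refl (weaken (λ x∈R₇ → inj₂ (inj₂ (inj₁ (refl , x∈R₇)))) (All.lookup completions₇ r₁∈R₇))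
lemma6 .(2 * (2 + p)) _ r₁ (inj₂ (inj₂ (inj₂ (inj₁ (suc (suc p) , s≤s (s≤s z≤n) , refl , r₁≤2n))))) =
  completion⇒goal (Even.m≡2+k p) (Even.completion p r₁≤2n)
lemma6 .(2 * (4 + w) + 1) _ r₁
  (inj₂ (inj₂ (inj₂ (inj₂ (suc (suc (suc (suc w))) , 3<n@(s≤s (s≤s (s≤s (s≤s z≤n)))) , refl , r₁∈R))))) =
  completion⇒goal (Odd.m≡2+k (2 + w) 3<n) (Odd.completion (2 + w) 3<n r₁∈R)
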